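{- Let $C=(c_{i,j})_{i,j\ge1}$ be an infinite non-singular upper triangular matrix over $\mathbb{Z}_2$ (i.e. $c_{i,i}=1$ and $c_{i,j}=0$ for $i>j$), and let $X^C=(x_n)_{n\ge0}$ be the associated digital NUT sequence. Let $N\in\mathbb{N}$ be written as $N=2^{n_1}+2^{n_2}+\cdots+2^{n_r}$ with integers $n_1>n_2>\cdots>n_r\ge 0$ and $r\in\mathbb{N}$. For $j\in\{n_r+1,\dots,n_1+1\}$ define $\sigma_{r,j}\in\{0,1\}$ by $$\sigma_{r,j}=\sum_{k=j}^{n_1+1} c_{j,k}\,v_k \pmod 2,$$ where $v_k=1$ if $k=n_l+1$ for some $l\in\{1,\dots,r-1\}$ and $v_k=0$ otherwise (equivalently, $(\sigma_{r,n_r+1},\dots,\sigma_{r,n_1+1})^\top$ is the product over $\mathbb{Z}_2$ of the submatrix $(c_{i,k})_{i,k=n_r+1}^{n_1+1}$ with the vector whose entries are $1$ exactly at the positions $n_l-n_r+1$, $l\in\{1,\dots,r-1\}$). Then $$\int_0^1 \Delta_{X_N^C}(t)\,\mathrm{d}t=\sum_{i=2}^r\sigma_{r,n_i+1}-\sum_{k=2}^r\sum_{j=n_k+1}^{n_{k-1}}\frac{\sigma_{r,j}}{2^j}\sum_{i=k}^r 2^{n_i}+O(1),$$ where the $O(1)$ term is bounded in absolute value by a constant independent of $N$.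
   Context: $\mathbb{Z}_2=\{0,1\}$ is the field with two elements. Given an infinite matrix $C=(c_{i,j})_{i,j\ge1}$ over $\mathbb{Z}_2$ that is non-singular upper triangular (NUT), the digital sequence $X^C=(x_n)_{n\ge0}$ is defined as follows: for $n\in\mathbb{N}_0$ with binary expansion $n=n_0+n_12+n_22^2+\cdots$, let $\vec n=(n_0,n_1,n_2,\dots)^\top$, compute $C\vec n=(y_1^{(n)},y_2^{(n)},\dots)^\top$ over $\mathbb{Z}_2$, and set $x_n=\sum_{i\ge1}y_i^{(n)}2^{ -i}$. For $N\in\mathbb{N}$, $X_N^C=\{x_0,\dots,x_{N-1}\}$. For a finite point set $\mathcal{P}=\{x_0,\dots,x_{N-1}\}\subset[0,1)$ the discrepancy function is $\Delta_{\mathcal P}(t)=\sum_{n=0}^{N-1}\mathbf{1}_{[0,t)}(x_n)-Nt$ for $t\in[0,1]$. -}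

module Defs where

open import Data.Bool using (Bool; true; false; _xor_; _∧_; _∨_; if_then_else_)
open import Data.Nat as ℕ using (ℕ; zero; suc; _∸_; _≡ᵇ_)
open import Data.Nat.DivMod using (_/_; _%_)
open import Data.List using (List; map; upTo; foldr)
open import Data.Integer using (+_)
open import Data.Rational as ℚ using (ℚ; 0ℚ; 1ℚ; ½)
open import Relation.Binary.PropositionalEquality using (_≡_)

range : ℕ → ℕ → List ℕ
range a b = map (a ℕ.+_) (upTo (suc b ∸ a))

ΣQ : ℕ → ℕ → (ℕ → ℚ) → ℚ
ΣQ a b f = foldr ℚ._+_ 0ℚ (map f (range a b))

ΣN : ℕ → ℕ → (ℕ → ℕ) → ℕ
ΣN a b f = foldr ℕ._+_ 0 (map f (range a b))

ΣZ2 : ℕ → ℕ → (ℕ → Bool) → Bool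
ΣZ2 a b f = foldr _xor_ false (map f (range a b))

anyR : ℕ → ℕ → (ℕ → Bool) → Bool
anyR a b p = foldr _∨_ false (map p (range a b))

toℚ : ℕ → ℚ
toℚ n = (+ n) ℚ./ 1

bitℚ : Bool → ℚ
bitℚ true = 1ℚ
bitℚ false = 0ℚ

halfPow : ℕ → ℚ
halfPow zero = 1ℚ
halfPow (suc j) = ½ ℚ.* halfPow j

-- An infinite matrix over ℤ_2, indexed 1-based: C i j = c_{i,j} for i,j ≥ 1
-- (values at index 0 are irrelevant).
Matrix : Set
Matrix = ℕ → ℕ → Bool

NUT : Matrix → Set
NUT C = (∀ i → C (suc i) (suc i) ≡ true)
      × (∀ i j → j ℕ.< i → C (suc i) (suc j) ≡ false)
  where open import Data.Product using (_×_)

digit : ℕ → ℕ → Bool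
digit n zero = n % 2 ≡ᵇ 1
digit n (suc k) = digit (n / 2) k

-- y_i^{(n)} = Σ_{j≥1} c_{i,j} n_{j-1}; the digits n_{j-1} vanish for j > n,
-- so the sum over j ∈ {1..n} is the full sum.
yDigit : Matrix → ℕ → ℕ → Bool
yDigit C n i = ΣZ2 1 n (λ j → C i j ∧ digit n (j ∸ 1))

-- x_n = Σ_{i≥1} y_i 2^{-i}; for NUT C, y_i = 0 for i > n (C upper triangular
-- and digits of n vanish beyond position n-1), so the sum over i ∈ {1..n} is exact.
xSeq : Matrix → ℕ → ℚ
xSeq C n = ΣQ 1 n (λ i → bitℚ (yDigit C n i) ℚ.* halfPow i)

-- ∫_0^1 Δ_{X_N^C}(t) dt, computed exactly:
-- ∫_0^1 1_{[0,t)}(x) dt = 1 - x  and  ∫_0^1 N t dt = N/2.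
intDiscrepancy : Matrix → ℕ → ℚ
intDiscrepancy C N = ΣQ 0 (N ∸ 1) (λ m → 1ℚ ℚ.- xSeq C m) ℚ.- (toℚ N ℚ.* ½)

StrictlyDecreasing : ℕ → (ℕ → ℕ) → Set
StrictlyDecreasing r e = ∀ l → 1 ℕ.≤ l → l ℕ.< r → e (suc l) ℕ.< e l

binN : ℕ → (ℕ → ℕ) → ℕ
binN r e = ΣN 1 r (λ l → 2 ℕ.^ e l)

vVec : ℕ → (ℕ → ℕ) → ℕ → Bool
vVec r e k = anyR 1 (r ∸ 1) (λ l → k ≡ᵇ suc (e l))

sigma : Matrix → ℕ → (ℕ → ℕ) → ℕ → Bool
sigma C r e j = ΣZ2 j (suc (e 1)) (λ k → C j k ∧ vVec r e k)

mainTerm : Matrix → ℕ → (ℕ → ℕ) → ℚ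
mainTerm C r e =
  ΣQ 2 r (λ i → bitℚ (sigma C r e (suc (e i))))
  ℚ.- ΣQ 2 r (λ k →
        ΣQ (suc (e k)) (e (k ∸ 1)) (λ j →
          (bitℚ (sigma C r e j) ℚ.* halfPow j)
            ℚ.* toℚ (ΣN k r (λ i → 2 ℕ.^ e i))))

{-# OPTIONS --safe #-}
-- Write N = A_r with A_l = 2^{n_1} + ⋯ + 2^{n_l} and split [0, N) into the dyadic
-- blocks A_l + [0, 2^{n_{l+1}}).  The digits of A_l below n_{l+1} vanish and C is
-- upper triangular with unit diagonal, so on such a block the first n_{l+1} digits
-- of x_m run through all patterns while the later ones are those of x_{A_l}: the
-- block contributes (2^{n_{l+1}} - 1)/2 + 2^{n_{l+1}} τ, τ the tail of x_{A_l}
-- beyond digit n_{l+1}.  Adding 2^{n_{l+1}} to A_l flips digit n_{l+1} + 1 of y and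
-- keeps all later ones, so every such tail is expressed through the tails of
-- x_{A_{r-1}}, whose digits are the σ_{r,j} because the binary digits of A_{r-1}
-- are the v_k.  Summation by parts against the weights 2^{n_k} + ⋯ + 2^{n_r} turns
-- the result into the main term, up to ½ + σ_{r,n_1+1} - σ_{r,n_r+1} - N τ′ with
-- 0 ≤ τ′ ≤ 2^{-n_1} and N < 2^{n_1+1}.
module Submission where

open import Defs
open import Data.Nat using (ℕ; _≤_)
open import Data.Product using (Σ)
open import Data.Rational using (ℚ; ∣_∣; _-_) renaming (_≤_ to _≤ℚ_)

open import Algebra.Bundles using (CommutativeRing)
open import Algebra.Structures using (IsCommutativeMonoid)
open import Data.Bool using (Bool; true; false; _xor_; _∧_; _∨_; not; T)
import Data.Bool.Properties as 𝔹
open import Data.List using (map; foldr; applyUpTo)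
open import Data.Nat as ℕ using (zero; suc; _+_; _*_; _∸_; _^_; _<_; z≤n; s≤s; _≡ᵇ_)
import Data.Nat.Properties as ℕP
open import Data.Nat.Divisibility using (divides-refl)
open import Data.Nat.DivMod using (_/_; _%_)
import Data.Nat.DivMod as ℕD
import Data.Nat.Coprimality as Coprime
import Data.Integer as ℤ
import Data.Integer.Properties as ℤP
open import Data.Rational as ℚ using (0ℚ; 1ℚ; ½; mkℚ)
import Data.Rational.Properties as ℚP
open import Data.Product using (_×_; _,_; proj₁; proj₂)
open import Data.Sum using (inj₁; inj₂)
open import Data.Unit using (tt)
open import Function using (case_of_)
open import Level using (0ℓ)
open import Relation.Binary.PropositionalEquality
open import Relation.Nullary using (yes; no)
open import Relation.Nullary.Decidable using (dec-true; dec-false; dec⇒maybe; toWitness)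
open import Tactic.RingSolver using (solve-∀)
import Tactic.RingSolver.Core.AlmostCommutativeRing as ACR

module FiniteSum {A : Set} {_∙_ : A → A → A} {ε : A}
                 (isCM : IsCommutativeMonoid _≡_ _∙_ ε) where
  open IsCommutativeMonoid isCM using (assoc; identityˡ; identityʳ; comm)
  open ≡-Reasoning

  Σ< : ℕ → (ℕ → A) → A
  Σ< zero    f = ε
  Σ< (suc n) f = f 0 ∙ Σ< n (λ m → f (suc m))

  foldr-range≡Σ< : ∀ a b f →
    foldr _∙_ ε (map f (range a b)) ≡ Σ< (suc b ∸ a) (λ m → f (a + m))
  foldr-range≡Σ< a b f = go (suc b ∸ a) (λ m → a + m) (λ m → m)
    where
    go : ∀ n (g h : ℕ → ℕ) → foldr _∙_ ε (map f (map g (applyUpTo h n))) ≡ Σ< n (λ m → f (g (h m)))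
    go zero    g h = refl
    go (suc n) g h = cong (f (g (h 0)) ∙_) (go n g (λ m → h (suc m)))

  Σ<-cong : ∀ n {f g} → (∀ m → m < n → f m ≡ g m) → Σ< n f ≡ Σ< n g
  Σ<-cong zero    eq = refl
  Σ<-cong (suc n) eq = cong₂ _∙_ (eq 0 (s≤s z≤n)) (Σ<-cong n (λ m m<n → eq (suc m) (s≤s m<n)))

  Σ<-+ : ∀ m n f → Σ< (m + n) f ≡ Σ< m f ∙ Σ< n (λ k → f (m + k))
  Σ<-+ zero    n f = sym (identityˡ _)
  Σ<-+ (suc m) n f = trans (cong (f 0 ∙_) (Σ<-+ m n (λ k → f (suc k)))) (sym (assoc _ _ _))

  Σ<-suc : ∀ n f → Σ< (suc n) f ≡ Σ< n f ∙ f n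
  Σ<-suc n f = begin
    Σ< (suc n) f             ≡⟨ cong (λ k → Σ< k f) (ℕP.+-comm 1 n) ⟩
    Σ< (n + 1) f             ≡⟨ Σ<-+ n 1 f ⟩
    Σ< n f ∙ (f (n + 0) ∙ ε) ≡⟨ cong (Σ< n f ∙_) (trans (identityʳ _) (cong f (ℕP.+-identityʳ n))) ⟩
    Σ< n f ∙ f n             ∎

  Σ<-ε : ∀ n f → (∀ m → m < n → f m ≡ ε) → Σ< n f ≡ ε
  Σ<-ε n f f≡ε = trans (Σ<-cong n f≡ε) (go n)
    where
    go : ∀ n → Σ< n (λ _ → ε) ≡ ε
    go zero    = refl
    go (suc n) = trans (identityˡ _) (go n)

  Σ<-∙ : ∀ n f g → Σ< n (λ m → f m ∙ g m) ≡ Σ< n f ∙ Σ< n g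
  Σ<-∙ zero    f g = sym (identityˡ ε)
  Σ<-∙ (suc n) f g = trans (cong ((f 0 ∙ g 0) ∙_) (Σ<-∙ n _ _)) (interchange _ _ _ _)
    where
    interchange : ∀ a b c d → (a ∙ b) ∙ (c ∙ d) ≡ (a ∙ c) ∙ (b ∙ d)
    interchange a b c d = begin
      (a ∙ b) ∙ (c ∙ d) ≡⟨ assoc a b (c ∙ d) ⟩
      a ∙ (b ∙ (c ∙ d)) ≡⟨ cong (a ∙_) (sym (assoc b c d)) ⟩
      a ∙ ((b ∙ c) ∙ d) ≡⟨ cong (λ x → a ∙ (x ∙ d)) (comm b c) ⟩
      a ∙ ((c ∙ b) ∙ d) ≡⟨ cong (a ∙_) (assoc c b d) ⟩
      a ∙ (c ∙ (b ∙ d)) ≡⟨ sym (assoc a c (b ∙ d)) ⟩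
      (a ∙ c) ∙ (b ∙ d) ∎

  Σ<-extend : ∀ n M f → n ≤ M → (∀ m → n ≤ m → m < M → f m ≡ ε) → Σ< M f ≡ Σ< n f
  Σ<-extend n M f n≤M f≡ε = begin
    Σ< M f                                   ≡⟨ cong (λ k → Σ< k f) (sym (ℕP.m+[n∸m]≡n n≤M)) ⟩
    Σ< (n + (M ∸ n)) f                       ≡⟨ Σ<-+ n (M ∸ n) f ⟩
    Σ< n f ∙ Σ< (M ∸ n) (λ k → f (n + k))    ≡⟨ cong (Σ< n f ∙_) (Σ<-ε (M ∸ n) _ beyond) ⟩
    Σ< n f ∙ ε                               ≡⟨ identityʳ _ ⟩
    Σ< n f                                   ∎
    where
    beyond : ∀ k → k < M ∸ n → f (n + k) ≡ ε
    beyond k k<M∸n = f≡ε (n + k) (ℕP.m≤m+n n k)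
      (subst (n + k <_) (ℕP.m+[n∸m]≡n n≤M) (ℕP.+-monoʳ-< n k<M∸n))

  Σ<-window : ∀ a n M f → a + n ≤ M → (∀ m → m < a → f m ≡ ε) →
    (∀ m → a + n ≤ m → m < M → f m ≡ ε) → Σ< M f ≡ Σ< n (λ k → f (a + k))
  Σ<-window a n M f a+n≤M below above = begin
    Σ< M f
      ≡⟨ cong (λ k → Σ< k f) (sym (ℕP.m+[n∸m]≡n a≤M)) ⟩
    Σ< (a + (M ∸ a)) f
      ≡⟨ Σ<-+ a (M ∸ a) f ⟩
    Σ< a f ∙ Σ< (M ∸ a) (λ k → f (a + k))
      ≡⟨ cong₂ _∙_ (Σ<-ε a f below) (Σ<-extend n (M ∸ a) _ n≤M∸a above′) ⟩
    ε ∙ Σ< n (λ k → f (a + k))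
      ≡⟨ identityˡ _ ⟩
    Σ< n (λ k → f (a + k)) ∎
    where
    a≤M : a ≤ M
    a≤M = ℕP.≤-trans (ℕP.m≤m+n a n) a+n≤M
    n≤M∸a : n ≤ M ∸ a
    n≤M∸a = subst (_≤ M ∸ a) (ℕP.m+n∸m≡n a n) (ℕP.∸-monoˡ-≤ a a+n≤M)
    above′ : ∀ k → n ≤ k → k < M ∸ a → f (a + k) ≡ ε
    above′ k n≤k k<M∸a = above (a + k) (ℕP.+-monoʳ-≤ a n≤k)
      (subst (a + k <_) (ℕP.m+[n∸m]≡n a≤M) (ℕP.+-monoʳ-< a k<M∸a))

xor-isCommutativeMonoid : IsCommutativeMonoid _≡_ _xor_ false
xor-isCommutativeMonoid = CommutativeRing.+-isCommutativeMonoid 𝔹.xor-∧-commutativeRing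

open FiniteSum ℚP.+-0-isCommutativeMonoid
module Xor = FiniteSum xor-isCommutativeMonoid
module Or  = FiniteSum 𝔹.∨-isCommutativeMonoid
module Nat = FiniteSum ℕP.+-0-isCommutativeMonoid

-- The zero test is needed: without it the solver keeps vanishing coefficients and
-- fails on identities involving constants such as ½.
ℚ-ring : ACR.AlmostCommutativeRing 0ℓ 0ℓ
ℚ-ring = ACR.fromCommutativeRing ℚP.+-*-commutativeRing (λ x → dec⇒maybe (0ℚ ℚP.≟ x))

toℚ-+ : ∀ m n → toℚ (m + n) ≡ toℚ m ℚ.+ toℚ n
toℚ-+ m n = begin
  toℚ (m + n)                                   ≡⟨ ℚP./-cong ℤ-eq refl ⟩
  (ℤ.+ m ℤ.* ℤ.+ 1 ℤ.+ ℤ.+ n ℤ.* ℤ.+ 1) ℚ./ 1   ≡⟨ sym (cong₂ ℚ._+_ (toℚ≡mkℚ m) (toℚ≡mkℚ n)) ⟩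
  toℚ m ℚ.+ toℚ n                               ∎
  where
  open ≡-Reasoning
  toℚ≡mkℚ : ∀ n → toℚ n ≡ mkℚ (ℤ.+ n) 0 (Coprime.sym (Coprime.1-coprimeTo n))
  toℚ≡mkℚ n = ℚP.normalize-coprime _
  ℤ-eq : ℤ.+ (m + n) ≡ ℤ.+ m ℤ.* ℤ.+ 1 ℤ.+ ℤ.+ n ℤ.* ℤ.+ 1
  ℤ-eq = trans (ℤP.pos-+ m n) (sym (cong₂ ℤ._+_ (ℤP.*-identityʳ (ℤ.+ m)) (ℤP.*-identityʳ (ℤ.+ n))))

toℚ-Σ< : ∀ n f → toℚ (Nat.Σ< n f) ≡ Σ< n (λ m → toℚ (f m))
toℚ-Σ< zero    f = refl
toℚ-Σ< (suc n) f = trans (toℚ-+ (f 0) _) (cong (toℚ (f 0) ℚ.+_) (toℚ-Σ< n (λ m → f (suc m))))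

0≤toℚ : ∀ n → 0ℚ ℚ.≤ toℚ n
0≤toℚ n = ℚP.nonNegative⁻¹ (toℚ n) {{ℚP.normalize-nonNeg n 1}}

toℚ-mono-≤ : ∀ {m n} → m ≤ n → toℚ m ℚ.≤ toℚ n
toℚ-mono-≤ {m} {n} m≤n = begin
  toℚ m                     ≡⟨ ℚP.+-identityʳ (toℚ m) ⟨
  toℚ m ℚ.+ 0ℚ              ≤⟨ ℚP.+-monoʳ-≤ (toℚ m) (0≤toℚ (n ∸ m)) ⟩
  toℚ m ℚ.+ toℚ (n ∸ m)     ≡⟨ toℚ-+ m (n ∸ m) ⟨
  toℚ (m + (n ∸ m))         ≡⟨ cong toℚ (ℕP.m+[n∸m]≡n m≤n) ⟩
  toℚ n                     ∎
  where open ℚP.≤-Reasoning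

Σ<-*ʳ : ∀ n f c → Σ< n (λ m → f m ℚ.* c) ≡ Σ< n f ℚ.* c
Σ<-*ʳ zero    f c = sym (ℚP.*-zeroˡ c)
Σ<-*ʳ (suc n) f c = trans (cong (f 0 ℚ.* c ℚ.+_) (Σ<-*ʳ n (λ m → f (suc m)) c))
                          (sym (ℚP.*-distribʳ-+ c (f 0) _))

Σ<-1- : ∀ n f → Σ< n (λ m → 1ℚ ℚ.- f m) ≡ toℚ n ℚ.- Σ< n f
Σ<-1- zero    f = refl
Σ<-1- (suc n) f = begin
  (1ℚ ℚ.- f 0) ℚ.+ Σ< n (λ m → 1ℚ ℚ.- f (suc m))
    ≡⟨ cong ((1ℚ ℚ.- f 0) ℚ.+_) (Σ<-1- n (λ m → f (suc m))) ⟩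
  (1ℚ ℚ.- f 0) ℚ.+ (toℚ n ℚ.- Σ< n (λ m → f (suc m)))
    ≡⟨ algebra (f 0) (toℚ n) (Σ< n (λ m → f (suc m))) ⟩
  (1ℚ ℚ.+ toℚ n) ℚ.- Σ< (suc n) f
    ≡⟨ cong (ℚ._- Σ< (suc n) f) (toℚ-+ 1 n) ⟨
  toℚ (suc n) ℚ.- Σ< (suc n) f ∎
  where
  open ≡-Reasoning
  algebra : ∀ a n s → (1ℚ ℚ.- a) ℚ.+ (n ℚ.- s) ≡ (1ℚ ℚ.+ n) ℚ.- (a ℚ.+ s)
  algebra = solve-∀ ℚ-ring

Σ<-by-parts : ∀ n (Q τ : ℕ → ℚ) →
  Σ< n (λ k → Q (suc k) ℚ.* (τ (suc k) ℚ.- τ k)) ≡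
  Q n ℚ.* τ n ℚ.- Q 0 ℚ.* τ 0 ℚ.+ Σ< n (λ k → (Q k ℚ.- Q (suc k)) ℚ.* τ k)
Σ<-by-parts zero    Q τ = sym (algebra (Q 0) (τ 0))
  where
  algebra : ∀ q t → q ℚ.* t ℚ.- q ℚ.* t ℚ.+ 0ℚ ≡ 0ℚ
  algebra = solve-∀ ℚ-ring
Σ<-by-parts (suc n) Q τ = begin
  Σ< (suc n) (λ k → Q (suc k) ℚ.* (τ (suc k) ℚ.- τ k))
    ≡⟨ Σ<-suc n _ ⟩
  Σ< n (λ k → Q (suc k) ℚ.* (τ (suc k) ℚ.- τ k)) ℚ.+ Q (suc n) ℚ.* (τ (suc n) ℚ.- τ n)
    ≡⟨ cong (ℚ._+ Q (suc n) ℚ.* (τ (suc n) ℚ.- τ n)) (Σ<-by-parts n Q τ) ⟩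
  Q n ℚ.* τ n ℚ.- Q 0 ℚ.* τ 0 ℚ.+ R ℚ.+ Q (suc n) ℚ.* (τ (suc n) ℚ.- τ n)
    ≡⟨ algebra (Q n) (τ n) (Q 0 ℚ.* τ 0) R (Q (suc n)) (τ (suc n)) ⟩
  Q (suc n) ℚ.* τ (suc n) ℚ.- Q 0 ℚ.* τ 0 ℚ.+ (R ℚ.+ (Q n ℚ.- Q (suc n)) ℚ.* τ n)
    ≡⟨ cong (λ x → Q (suc n) ℚ.* τ (suc n) ℚ.- Q 0 ℚ.* τ 0 ℚ.+ x) (Σ<-suc n _) ⟨
  Q (suc n) ℚ.* τ (suc n) ℚ.- Q 0 ℚ.* τ 0 ℚ.+ Σ< (suc n) (λ k → (Q k ℚ.- Q (suc k)) ℚ.* τ k) ∎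
  where
  open ≡-Reasoning
  R : ℚ
  R = Σ< n (λ k → (Q k ℚ.- Q (suc k)) ℚ.* τ k)
  algebra : ∀ q t z r q′ t′ →
    q ℚ.* t ℚ.- z ℚ.+ r ℚ.+ q′ ℚ.* (t′ ℚ.- t) ≡ q′ ℚ.* t′ ℚ.- z ℚ.+ (r ℚ.+ (q ℚ.- q′) ℚ.* t)
  algebra = solve-∀ ℚ-ring

0≤1 : 0ℚ ℚ.≤ 1ℚ
0≤1 = toWitness {a? = 0ℚ ℚP.≤? 1ℚ} _

*-mono-≤-nonNeg : ∀ {a b c d} → 0ℚ ℚ.≤ a → a ℚ.≤ b → 0ℚ ℚ.≤ c → c ℚ.≤ d → a ℚ.* c ℚ.≤ b ℚ.* d
*-mono-≤-nonNeg {a} {b} {c} {d} 0≤a a≤b 0≤c c≤d = ℚP.≤-trans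
  (ℚP.*-monoʳ-≤-nonNeg c {{ℚ.nonNegative 0≤c}} a≤b)
  (ℚP.*-monoˡ-≤-nonNeg b {{ℚ.nonNegative (ℚP.≤-trans 0≤a a≤b)}} c≤d)

0≤p≤q⇒∣p∣≤q : ∀ {p q} → 0ℚ ℚ.≤ p → p ℚ.≤ q → ∣ p ∣ ℚ.≤ q
0≤p≤q⇒∣p∣≤q 0≤p p≤q = subst (ℚ._≤ _) (sym (ℚP.0≤p⇒∣p∣≡p 0≤p)) p≤q

∣½+a-b-c∣≤ : ∀ {a b c} → 0ℚ ℚ.≤ a × a ℚ.≤ 1ℚ → 0ℚ ℚ.≤ b × b ℚ.≤ 1ℚ → 0ℚ ℚ.≤ c × c ℚ.≤ 1ℚ ℚ.+ 1ℚ →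
  ∣ ½ ℚ.+ a ℚ.- b ℚ.- c ∣ ℚ.≤ ½ ℚ.+ 1ℚ ℚ.+ 1ℚ ℚ.+ (1ℚ ℚ.+ 1ℚ)
∣½+a-b-c∣≤ {a} {b} {c} (0≤a , a≤1) (0≤b , b≤1) (0≤c , c≤2) = begin
  ∣ ½ ℚ.+ a ℚ.- b ℚ.- c ∣               ≤⟨ ℚP.∣p-q∣≤∣p∣+∣q∣ (½ ℚ.+ a ℚ.- b) c ⟩
  ∣ ½ ℚ.+ a ℚ.- b ∣ ℚ.+ ∣ c ∣           ≤⟨ ℚP.+-monoˡ-≤ ∣ c ∣ (ℚP.∣p-q∣≤∣p∣+∣q∣ (½ ℚ.+ a) b) ⟩
  ∣ ½ ℚ.+ a ∣ ℚ.+ ∣ b ∣ ℚ.+ ∣ c ∣       ≤⟨ ℚP.+-monoˡ-≤ ∣ c ∣ (ℚP.+-monoˡ-≤ ∣ b ∣ (ℚP.∣p+q∣≤∣p∣+∣q∣ ½ a)) ⟩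
  ∣ ½ ∣ ℚ.+ ∣ a ∣ ℚ.+ ∣ b ∣ ℚ.+ ∣ c ∣   ≤⟨ ℚP.+-mono-≤ (ℚP.+-mono-≤ (ℚP.+-monoʳ-≤ ½ ∣a∣≤1) ∣b∣≤1) ∣c∣≤2 ⟩
  ½ ℚ.+ 1ℚ ℚ.+ 1ℚ ℚ.+ (1ℚ ℚ.+ 1ℚ)       ∎
  where
  open ℚP.≤-Reasoning
  ∣a∣≤1 : ∣ a ∣ ℚ.≤ 1ℚ
  ∣a∣≤1 = 0≤p≤q⇒∣p∣≤q 0≤a a≤1
  ∣b∣≤1 : ∣ b ∣ ℚ.≤ 1ℚ
  ∣b∣≤1 = 0≤p≤q⇒∣p∣≤q 0≤b b≤1
  ∣c∣≤2 : ∣ c ∣ ℚ.≤ 1ℚ ℚ.+ 1ℚ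
  ∣c∣≤2 = 0≤p≤q⇒∣p∣≤q 0≤c c≤2

bitℚ-not : ∀ b → bitℚ (not b) ≡ 1ℚ ℚ.- bitℚ b
bitℚ-not true  = refl
bitℚ-not false = refl

bitℚ-bounds : ∀ b → 0ℚ ℚ.≤ bitℚ b × bitℚ b ℚ.≤ 1ℚ
bitℚ-bounds true  = 0≤1 , ℚP.≤-refl
bitℚ-bounds false = ℚP.≤-refl , 0≤1

0≤halfPow : ∀ k → 0ℚ ℚ.≤ halfPow k
0≤halfPow zero    = 0≤1
0≤halfPow (suc k) = subst (ℚ._≤ ½ ℚ.* halfPow k) (ℚP.*-zeroʳ ½) (ℚP.*-monoˡ-≤-nonNeg ½ (0≤halfPow k))

halfPow-suc+ : ∀ k → halfPow (suc k) ℚ.+ halfPow (suc k) ≡ halfPow k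
halfPow-suc+ k = algebra (halfPow k)
  where
  algebra : ∀ h → ½ ℚ.* h ℚ.+ ½ ℚ.* h ≡ h
  algebra = solve-∀ ℚ-ring

pow2 : ℕ → ℚ
pow2 k = toℚ (2 ^ k)

pow2-suc : ∀ k → pow2 (suc k) ≡ pow2 k ℚ.+ pow2 k
pow2-suc k = trans (cong toℚ (cong (2 ^ k +_) (ℕP.+-identityʳ (2 ^ k)))) (toℚ-+ (2 ^ k) (2 ^ k))

pow2*halfPow : ∀ k → pow2 k ℚ.* halfPow k ≡ 1ℚ
pow2*halfPow zero    = refl
pow2*halfPow (suc k) = begin
  pow2 (suc k) ℚ.* halfPow (suc k)        ≡⟨ cong (ℚ._* halfPow (suc k)) (pow2-suc k) ⟩
  (pow2 k ℚ.+ pow2 k) ℚ.* (½ ℚ.* halfPow k) ≡⟨ algebra (pow2 k) (halfPow k) ⟩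
  pow2 k ℚ.* halfPow k                    ≡⟨ pow2*halfPow k ⟩
  1ℚ                                      ∎
  where
  open ≡-Reasoning
  algebra : ∀ p h → (p ℚ.+ p) ℚ.* (½ ℚ.* h) ≡ p ℚ.* h
  algebra = solve-∀ ℚ-ring

pow2-suc*halfPow : ∀ k → pow2 (suc k) ℚ.* halfPow k ≡ 1ℚ ℚ.+ 1ℚ
pow2-suc*halfPow k = begin
  pow2 (suc k) ℚ.* halfPow k                           ≡⟨ cong (ℚ._* halfPow k) (pow2-suc k) ⟩
  (pow2 k ℚ.+ pow2 k) ℚ.* halfPow k                    ≡⟨ ℚP.*-distribʳ-+ (halfPow k) (pow2 k) (pow2 k) ⟩
  pow2 k ℚ.* halfPow k ℚ.+ pow2 k ℚ.* halfPow k        ≡⟨ cong₂ ℚ._+_ (pow2*halfPow k) (pow2*halfPow k) ⟩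
  1ℚ ℚ.+ 1ℚ                                            ∎
  where open ≡-Reasoning

pow2*halfPow-suc : ∀ k → pow2 k ℚ.* halfPow (suc k) ≡ ½
pow2*halfPow-suc k = begin
  pow2 k ℚ.* (½ ℚ.* halfPow k) ≡⟨ algebra (pow2 k) (halfPow k) ⟩
  ½ ℚ.* (pow2 k ℚ.* halfPow k) ≡⟨ cong (½ ℚ.*_) (pow2*halfPow k) ⟩
  ½                            ∎
  where
  open ≡-Reasoning
  algebra : ∀ p h → p ℚ.* (½ ℚ.* h) ≡ ½ ℚ.* (p ℚ.* h)
  algebra = solve-∀ ℚ-ring

binFrac : (ℕ → Bool) → ℕ → ℕ → ℚ
binFrac y a zero    = 0ℚ
binFrac y a (suc n) = bitℚ (y (suc a)) ℚ.* halfPow (suc a) ℚ.+ binFrac y (suc a) n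

Σ<≡binFrac : ∀ y a n →
  Σ< n (λ t → bitℚ (y (suc (a + t))) ℚ.* halfPow (suc (a + t))) ≡ binFrac y a n
Σ<≡binFrac y a zero    = refl
Σ<≡binFrac y a (suc n) = cong₂ ℚ._+_
  (cong (λ i → bitℚ (y (suc i)) ℚ.* halfPow (suc i)) (ℕP.+-identityʳ a))
  (trans (Σ<-cong n (λ t _ → cong (λ i → bitℚ (y (suc i)) ℚ.* halfPow (suc i)) (ℕP.+-suc a t)))
         (Σ<≡binFrac y (suc a) n))

binFrac-cong : ∀ {y y′} a n → (∀ i → a < i → i ≤ a + n → y i ≡ y′ i) → binFrac y a n ≡ binFrac y′ a n
binFrac-cong a zero    eq = refl
binFrac-cong a (suc n) eq = cong₂ ℚ._+_
  (cong (λ b → bitℚ b ℚ.* halfPow (suc a)) (eq (suc a) ℕP.≤-refl (within (s≤s (ℕP.m≤m+n a n)))))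
  (binFrac-cong (suc a) n (λ i a<i i≤ → eq i (ℕP.<-trans (ℕP.n<1+n a) a<i) (within i≤)))
  where
  within : ∀ {i} → i ≤ suc a + n → i ≤ a + suc n
  within {i} = subst (i ≤_) (sym (ℕP.+-suc a n))

binFrac-+ : ∀ y a m n → binFrac y a (m + n) ≡ binFrac y a m ℚ.+ binFrac y (a + m) n
binFrac-+ y a zero    n = trans (cong (λ b → binFrac y b n) (sym (ℕP.+-identityʳ a))) (sym (ℚP.+-identityˡ _))
binFrac-+ y a (suc m) n = begin
  b ℚ.+ binFrac y (suc a) (m + n)
    ≡⟨ cong (b ℚ.+_) (binFrac-+ y (suc a) m n) ⟩
  b ℚ.+ (binFrac y (suc a) m ℚ.+ binFrac y (suc a + m) n)
    ≡⟨ sym (ℚP.+-assoc b _ _) ⟩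
  b ℚ.+ binFrac y (suc a) m ℚ.+ binFrac y (suc a + m) n
    ≡⟨ cong (λ c → b ℚ.+ binFrac y (suc a) m ℚ.+ binFrac y c n) (sym (ℕP.+-suc a m)) ⟩
  b ℚ.+ binFrac y (suc a) m ℚ.+ binFrac y (a + suc m) n ∎
  where
  open ≡-Reasoning
  b : ℚ
  b = bitℚ (y (suc a)) ℚ.* halfPow (suc a)

binFrac-split : ∀ y {a b c} → a ≤ b → b ≤ c →
  binFrac y a (c ∸ a) ≡ binFrac y a (b ∸ a) ℚ.+ binFrac y b (c ∸ b)
binFrac-split y {a} {b} {c} a≤b b≤c = begin
  binFrac y a (c ∸ a)
    ≡⟨ cong (binFrac y a) c∸a ⟩
  binFrac y a ((b ∸ a) + (c ∸ b))
    ≡⟨ binFrac-+ y a (b ∸ a) (c ∸ b) ⟩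
  binFrac y a (b ∸ a) ℚ.+ binFrac y (a + (b ∸ a)) (c ∸ b)
    ≡⟨ cong (λ d → binFrac y a (b ∸ a) ℚ.+ binFrac y d (c ∸ b)) (ℕP.m+[n∸m]≡n a≤b) ⟩
  binFrac y a (b ∸ a) ℚ.+ binFrac y b (c ∸ b) ∎
  where
  open ≡-Reasoning
  c∸a : c ∸ a ≡ (b ∸ a) + (c ∸ b)
  c∸a = begin
    c ∸ a                   ≡⟨ cong (_∸ a) (ℕP.m+[n∸m]≡n b≤c) ⟨
    b + (c ∸ b) ∸ a         ≡⟨ ℕP.+-∸-comm (c ∸ b) a≤b ⟩
    (b ∸ a) + (c ∸ b)       ∎

bit*-bounds : ∀ b {h} → 0ℚ ℚ.≤ h → 0ℚ ℚ.≤ bitℚ b ℚ.* h × bitℚ b ℚ.* h ℚ.≤ h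
bit*-bounds true  {h} 0≤h = subst (0ℚ ℚ.≤_) (sym (ℚP.*-identityˡ h)) 0≤h , ℚP.≤-reflexive (ℚP.*-identityˡ h)
bit*-bounds false {h} 0≤h = ℚP.≤-reflexive (sym (ℚP.*-zeroˡ h)) , subst (ℚ._≤ h) (sym (ℚP.*-zeroˡ h)) 0≤h

binFrac-bounds : ∀ y a n → 0ℚ ℚ.≤ binFrac y a n × binFrac y a n ℚ.≤ halfPow a
binFrac-bounds y a zero    = ℚP.≤-refl , 0≤halfPow a
binFrac-bounds y a (suc n) with bit*-bounds (y (suc a)) (0≤halfPow (suc a)) | binFrac-bounds y (suc a) n
... | lo₁ , hi₁ | lo₂ , hi₂ =
  ℚP.+-mono-≤ lo₁ lo₂ , ℚP.≤-trans (ℚP.+-mono-≤ hi₁ hi₂) (ℚP.≤-reflexive (halfPow-suc+ a))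

digit-≥ : ∀ {n} j → n ≤ j → digit n j ≡ false
digit-≥ {zero}  zero    _         = refl
digit-≥ {zero}  (suc j) _         = digit-≥ j z≤n
digit-≥ {suc n} (suc j) (s≤s n≤j) =
  digit-≥ j (ℕP.≤-pred (ℕP.<-≤-trans (ℕD.m/n<m (suc n) 2 (s≤s (s≤s z≤n))) (s≤s n≤j)))

digit₀≡false⇒%2≡0 : ∀ A → digit A 0 ≡ false → A % 2 ≡ 0
digit₀≡false⇒%2≡0 A d≡false with A % 2 | ℕD.m%n<n A 2
... | 0 | _ = refl
... | 1 | _ = case d≡false of λ ()   -- `with` has turned its type into true ≡ false
... | suc (suc _) | s≤s (s≤s ())

digit-+2^ : ∀ k A → digit A k ≡ false → ∀ j → digit (A + 2 ^ k) j ≡ digit A j xor (j ≡ᵇ k)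
digit-+2^ zero A d≡false zero = begin
  (A + 1) % 2 ≡ᵇ 1            ≡⟨ cong (_≡ᵇ 1) (ℕD.%-distribˡ-+ A 1 2) ⟩
  (A % 2 + 1) % 2 ≡ᵇ 1        ≡⟨ cong (λ r → (r + 1) % 2 ≡ᵇ 1) (digit₀≡false⇒%2≡0 A d≡false) ⟩
  true                        ≡⟨ cong (_xor true) d≡false ⟨
  digit A 0 xor true          ∎
  where open ≡-Reasoning
digit-+2^ zero A d≡false (suc j) = begin
  digit ((A + 1) / 2) j       ≡⟨ cong (λ n → digit n j) (ℕD.+-distrib-/ A 1 A%2+1<2) ⟩
  digit (A / 2 + 0) j         ≡⟨ cong (λ n → digit n j) (ℕP.+-identityʳ (A / 2)) ⟩
  digit (A / 2) j             ≡⟨ 𝔹.xor-identityʳ _ ⟨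
  digit (A / 2) j xor false   ∎
  where
  open ≡-Reasoning
  A%2+1<2 : A % 2 + 1 < 2
  A%2+1<2 = subst (λ r → r + 1 < 2) (sym (digit₀≡false⇒%2≡0 A d≡false)) ℕP.≤-refl
digit-+2^ (suc k) A d≡false zero = begin
  (A + 2 ^ suc k) % 2 ≡ᵇ 1    ≡⟨ cong (λ n → (A + n) % 2 ≡ᵇ 1) (ℕP.*-comm 2 (2 ^ k)) ⟩
  (A + 2 ^ k * 2) % 2 ≡ᵇ 1    ≡⟨ cong (_≡ᵇ 1) (ℕD.[m+kn]%n≡m%n A (2 ^ k) 2) ⟩
  digit A 0                   ≡⟨ 𝔹.xor-identityʳ _ ⟨
  digit A 0 xor false         ∎
  where open ≡-Reasoning
digit-+2^ (suc k) A d≡false (suc j) = begin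
  digit ((A + 2 ^ suc k) / 2) j          ≡⟨ cong (λ n → digit n j) halve ⟩
  digit (A / 2 + 2 ^ k) j                ≡⟨ digit-+2^ k (A / 2) d≡false j ⟩
  digit (A / 2) j xor (j ≡ᵇ k)           ∎
  where
  open ≡-Reasoning
  halve : (A + 2 ^ suc k) / 2 ≡ A / 2 + 2 ^ k
  halve = begin
    (A + 2 ^ suc k) / 2        ≡⟨ cong (λ n → (A + n) / 2) (ℕP.*-comm 2 (2 ^ k)) ⟩
    (A + 2 ^ k * 2) / 2        ≡⟨ ℕD.+-distrib-/-∣ʳ A (divides-refl (2 ^ k)) ⟩
    A / 2 + 2 ^ k * 2 / 2      ≡⟨ cong (A / 2 +_) (ℕD.m*n/n≡m (2 ^ k) 2) ⟩
    A / 2 + 2 ^ k              ∎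

≢⇒≡ᵇ-false : ∀ {m n} → m ≢ n → (m ≡ᵇ n) ≡ false
≢⇒≡ᵇ-false {m} {n} = dec-false (m ℕ.≟ n)

≡ᵇ-refl : ∀ n → (n ≡ᵇ n) ≡ true
≡ᵇ-refl n = dec-true (n ℕ.≟ n) refl

xor≡∨ : ∀ x y → (y ≡ true → x ≡ false) → x xor y ≡ x ∨ y
xor≡∨ x false _       = trans (𝔹.xor-identityʳ x) (sym (𝔹.∨-identityʳ x))
xor≡∨ x true  y⇒¬x rewrite y⇒¬x refl = refl

-- The exponents n_1 > ⋯ > n_r (n_l = e l, r = suc r′) indexed from 0: E l = n_{l+1},
-- and prefix l = A_l = 2^{n_1} + ⋯ + 2^{n_l}.
module Exponents (r′ : ℕ) (e : ℕ → ℕ) (e-dec : StrictlyDecreasing (suc r′) e) where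

  E : ℕ → ℕ
  E l = e (suc l)

  E-suc< : ∀ {l} → suc l ≤ r′ → E (suc l) < E l
  E-suc< {l} sl≤r′ = e-dec (suc l) (s≤s z≤n) (s≤s sl≤r′)

  E-< : ∀ {l m} → l < m → m ≤ r′ → E m < E l
  E-< {l} {suc m} (s≤s l≤m) sm≤r′ with ℕP.m≤n⇒m<n∨m≡n l≤m
  ... | inj₁ l<m  = ℕP.<-trans (E-suc< sm≤r′) (E-< l<m (ℕP.<⇒≤ sm≤r′))
  ... | inj₂ refl = E-suc< sm≤r′

  E-≤ : ∀ {l m} → l ≤ m → m ≤ r′ → E m ≤ E l
  E-≤ l≤m m≤r′ with ℕP.m≤n⇒m<n∨m≡n l≤m
  ... | inj₁ l<m  = ℕP.<⇒≤ (E-< l<m m≤r′)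
  ... | inj₂ refl = ℕP.≤-refl

  prefix : ℕ → ℕ
  prefix zero    = 0
  prefix (suc l) = prefix l + 2 ^ E l

  Σ<≡prefix : ∀ l → Nat.Σ< l (λ m → 2 ^ E m) ≡ prefix l
  Σ<≡prefix zero    = refl
  Σ<≡prefix (suc l) = trans (Nat.Σ<-suc l _) (cong (_+ 2 ^ E l) (Σ<≡prefix l))

  binN≡prefix : binN (suc r′) e ≡ prefix (suc r′)
  binN≡prefix = trans (Nat.foldr-range≡Σ< 1 (suc r′) _) (Σ<≡prefix (suc r′))

  exponentIn : ℕ → ℕ → Bool
  exponentIn l j = Or.Σ< l (λ m → j ≡ᵇ E m)

  exponentIn-false : ∀ l j → (∀ m → m < l → j ≢ E m) → exponentIn l j ≡ false
  exponentIn-false l j j≢E = Or.Σ<-ε l _ (λ m m<l → ≢⇒≡ᵇ-false (j≢E m m<l))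

  digit-prefix : ∀ l → l ≤ r′ → ∀ j → digit (prefix l) j ≡ exponentIn l j
  digit-prefix zero    _      j = digit-≥ j z≤n
  digit-prefix (suc l) sl≤r′ j = begin
    digit (prefix l + 2 ^ E l) j
      ≡⟨ digit-+2^ (E l) (prefix l) (trans (digit-prefix l l≤r′ (E l)) E-l-new) j ⟩
    digit (prefix l) j xor (j ≡ᵇ E l)
      ≡⟨ cong (_xor (j ≡ᵇ E l)) (digit-prefix l l≤r′ j) ⟩
    exponentIn l j xor (j ≡ᵇ E l)
      ≡⟨ xor≡∨ _ _ disjoint ⟩
    exponentIn l j ∨ (j ≡ᵇ E l)
      ≡⟨ Or.Σ<-suc l _ ⟨
    exponentIn (suc l) j ∎
    where
    open ≡-Reasoning
    l≤r′ : l ≤ r′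
    l≤r′ = ℕP.<⇒≤ sl≤r′
    E-l-new : exponentIn l (E l) ≡ false
    E-l-new = exponentIn-false l (E l) (λ m m<l eq → ℕP.<-irrefl eq (E-< m<l l≤r′))
    disjoint : (j ≡ᵇ E l) ≡ true → exponentIn l j ≡ false
    disjoint j≡ᵇ = subst (λ i → exponentIn l i ≡ false) (sym (ℕP.≡ᵇ⇒≡ j (E l) (subst T (sym j≡ᵇ) tt))) E-l-new

  digit-prefix-low : ∀ {l j} → l ≤ r′ → j ≤ E l → digit (prefix l) j ≡ false
  digit-prefix-low {l} {j} l≤r′ j≤El = trans (digit-prefix l l≤r′ j)
    (exponentIn-false l j (λ m m<l j≡Em → ℕP.<-irrefl j≡Em (ℕP.≤-<-trans j≤El (E-< m<l l≤r′))))

  digit-prefix-high : ∀ {j} → E 0 < j → digit (prefix r′) j ≡ false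
  digit-prefix-high {j} E0<j = trans (digit-prefix r′ ℕP.≤-refl j)
    (exponentIn-false r′ j (λ m m<r′ j≡Em → ℕP.<-irrefl (sym j≡Em) (ℕP.≤-<-trans (E-≤ z≤n (ℕP.<⇒≤ m<r′)) E0<j)))

  digit-prefix-stable : ∀ {l j} → l < r′ → E l ≤ j → digit (prefix r′) j ≡ digit (prefix (suc l)) j
  digit-prefix-stable {l} {j} l<r′ El≤j = begin
    digit (prefix r′) j        ≡⟨ digit-prefix r′ ℕP.≤-refl j ⟩
    exponentIn r′ j            ≡⟨ Or.Σ<-extend (suc l) r′ _ l<r′ later ⟩
    exponentIn (suc l) j       ≡⟨ digit-prefix (suc l) l<r′ j ⟨
    digit (prefix (suc l)) j   ∎
    where
    open ≡-Reasoning
    later : ∀ m → suc l ≤ m → m < r′ → (j ≡ᵇ E m) ≡ false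
    later m l<m m<r′ = ≢⇒≡ᵇ-false (λ j≡Em → ℕP.<-irrefl (sym j≡Em) (ℕP.<-≤-trans (E-< l<m (ℕP.<⇒≤ m<r′)) El≤j))

  vVec≡digit-prefix : ∀ j → vVec (suc r′) e (suc j) ≡ digit (prefix r′) j
  vVec≡digit-prefix j = trans (Or.foldr-range≡Σ< 1 r′ _) (sym (digit-prefix r′ ℕP.≤-refl j))

  prefix-bound : prefix (suc r′) ≤ 2 ^ suc (E 0)
  prefix-bound = ℕP.≤-trans (ℕP.+-monoʳ-≤ (prefix r′) (ℕP.^-monoʳ-≤ 2 (ℕP.n≤1+n (E r′)))) (room r′ ℕP.≤-refl)
    where
    room : ∀ l → l ≤ r′ → prefix l + 2 ^ suc (E l) ≤ 2 ^ suc (E 0)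
    room zero    _     = ℕP.≤-refl
    room (suc l) sl≤r′ = ℕP.≤-trans step (room l (ℕP.<⇒≤ sl≤r′))
      where
      open ℕP.≤-Reasoning
      step : prefix l + 2 ^ E l + 2 ^ suc (E (suc l)) ≤ prefix l + 2 ^ suc (E l)
      step = begin
        prefix l + 2 ^ E l + 2 ^ suc (E (suc l))
          ≤⟨ ℕP.+-monoʳ-≤ (prefix l + 2 ^ E l) (ℕP.^-monoʳ-≤ 2 (E-suc< sl≤r′)) ⟩
        prefix l + 2 ^ E l + 2 ^ E l
          ≡⟨ ℕP.+-assoc (prefix l) _ _ ⟩
        prefix l + (2 ^ E l + 2 ^ E l)
          ≡⟨ cong (λ n → prefix l + (2 ^ E l + n)) (ℕP.+-identityʳ (2 ^ E l)) ⟨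
        prefix l + 2 ^ suc (E l) ∎

module DigitalSequence (C : Matrix) (nut : NUT C) (B : ℕ) where

  C-diag : ∀ i → C (suc i) (suc i) ≡ true
  C-diag = proj₁ nut

  C-lower : ∀ i j → j < i → C (suc i) (suc j) ≡ false
  C-lower = proj₂ nut

  -- y A i = y_i^{(A)} and tail A k = Σ_{k<i≤B} y_i^{(A)} 2^{-i}, computed from the
  -- first B binary digits of A.
  y : ℕ → ℕ → Bool
  y A i = Xor.Σ< B (λ j → C i (suc j) ∧ digit A j)

  tail : ℕ → ℕ → ℚ
  tail A k = binFrac (y A) k (B ∸ k)

  yDigit≡y : ∀ {A} i → A ≤ B → yDigit C A i ≡ y A i
  yDigit≡y {A} i A≤B = trans (Xor.foldr-range≡Σ< 1 A _) (sym (Xor.Σ<-extend A B _ A≤B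
    (λ j A≤j _ → trans (cong (C i (suc j) ∧_) (digit-≥ j A≤j)) (𝔹.∧-zeroʳ _))))

  y-high : ∀ {A m} → A ≤ m → y A (suc m) ≡ false
  y-high {A} {m} A≤m = Xor.Σ<-ε B _ vanish
    where
    vanish : ∀ j → j < B → C (suc m) (suc j) ∧ digit A j ≡ false
    vanish j _ with j ℕ.<? m
    ... | yes j<m = cong (_∧ digit A j) (C-lower m j j<m)
    ... | no  j≮m = trans (cong (C (suc m) (suc j) ∧_) (digit-≥ j (ℕP.≤-trans A≤m (ℕP.≮⇒≥ j≮m)))) (𝔹.∧-zeroʳ _)

  xSeq≡tail : ∀ {A} → A ≤ B → xSeq C A ≡ tail A 0
  xSeq≡tail {A} A≤B = begin
    xSeq C A
      ≡⟨ foldr-range≡Σ< 1 A _ ⟩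
    Σ< A (λ m → bitℚ (yDigit C A (suc m)) ℚ.* halfPow (suc m))
      ≡⟨ Σ<-cong A (λ m _ → cong (λ b → bitℚ b ℚ.* halfPow (suc m)) (yDigit≡y (suc m) A≤B)) ⟩
    Σ< A (λ m → term (suc m))
      ≡⟨ Σ<-extend A B _ A≤B vanish ⟨
    Σ< B (λ m → term (suc m))
      ≡⟨ Σ<≡binFrac (y A) 0 B ⟩
    tail A 0 ∎
    where
    open ≡-Reasoning
    term : ℕ → ℚ
    term i = bitℚ (y A i) ℚ.* halfPow i
    vanish : ∀ m → A ≤ m → m < B → term (suc m) ≡ 0ℚ
    vanish m A≤m _ = trans (cong (λ b → bitℚ b ℚ.* halfPow (suc m)) (y-high A≤m)) (ℚP.*-zeroˡ (halfPow (suc m)))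

  y-local : ∀ {A A′} i → (∀ j → i ≤ j → digit A j ≡ digit A′ j) → y A (suc i) ≡ y A′ (suc i)
  y-local {A} {A′} i agree = Xor.Σ<-cong B termwise
    where
    termwise : ∀ j → j < B → C (suc i) (suc j) ∧ digit A j ≡ C (suc i) (suc j) ∧ digit A′ j
    termwise j _ with j ℕ.<? i
    ... | yes j<i rewrite C-lower i j j<i = refl
    ... | no  j≮i = cong (C (suc i) (suc j) ∧_) (agree j (ℕP.≮⇒≥ j≮i))

  tail-local : ∀ {A A′} k → (∀ j → k ≤ j → digit A j ≡ digit A′ j) → tail A k ≡ tail A′ k
  tail-local {A} {A′} k agree = binFrac-cong {y A} {y A′} k (B ∸ k) λ where
    (suc i) (s≤s k≤i) _ → y-local i (λ j i≤j → agree j (ℕP.≤-trans k≤i i≤j))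

  y-+2^ : ∀ {A k} i → k < B → digit A k ≡ false → y (A + 2 ^ k) i ≡ y A i xor C i (suc k)
  y-+2^ {A} {k} i k<B dₖ≡false = begin
    y (A + 2 ^ k) i
      ≡⟨ Xor.Σ<-cong B (λ j _ → trans (cong (c j ∧_) (digit-+2^ k A dₖ≡false j)) (𝔹.∧-distribˡ-xor (c j) _ _)) ⟩
    Xor.Σ< B (λ j → (c j ∧ digit A j) xor (c j ∧ (j ≡ᵇ k)))
      ≡⟨ Xor.Σ<-∙ B _ _ ⟩
    y A i xor Xor.Σ< B (λ j → c j ∧ (j ≡ᵇ k))
      ≡⟨ cong (y A i xor_) select ⟩
    y A i xor C i (suc k) ∎
    where
    open ≡-Reasoning
    c : ℕ → Bool
    c j = C i (suc j)
    off : ∀ {j} → j ≢ k → c j ∧ (j ≡ᵇ k) ≡ false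
    off {j} j≢k = trans (cong (c j ∧_) (≢⇒≡ᵇ-false j≢k)) (𝔹.∧-zeroʳ _)
    select : Xor.Σ< B (λ j → c j ∧ (j ≡ᵇ k)) ≡ c k
    select = begin
      Xor.Σ< B (λ j → c j ∧ (j ≡ᵇ k))
        ≡⟨ Xor.Σ<-window k 1 B _ (subst (_≤ B) (ℕP.+-comm 1 k) k<B) (λ j j<k → off (ℕP.<⇒≢ j<k))
             (λ j k+1≤j _ → off (λ j≡k → ℕP.<-irrefl (sym j≡k) (subst (_≤ j) (ℕP.+-comm k 1) k+1≤j))) ⟩
      (c (k + 0) ∧ (k + 0 ≡ᵇ k)) xor false
        ≡⟨ 𝔹.xor-identityʳ _ ⟩
      c (k + 0) ∧ (k + 0 ≡ᵇ k)
        ≡⟨ cong (λ j → c j ∧ (j ≡ᵇ k)) (ℕP.+-identityʳ k) ⟩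
      c k ∧ (k ≡ᵇ k)
        ≡⟨ cong (c k ∧_) (≡ᵇ-refl k) ⟩
      c k ∧ true
        ≡⟨ 𝔹.∧-identityʳ _ ⟩
      c k ∎

  y-+2^-diag : ∀ {A k} → k < B → digit A k ≡ false → y (A + 2 ^ k) (suc k) ≡ not (y A (suc k))
  y-+2^-diag {A} {k} k<B dₖ≡false = begin
    y (A + 2 ^ k) (suc k)            ≡⟨ y-+2^ (suc k) k<B dₖ≡false ⟩
    y A (suc k) xor C (suc k) (suc k) ≡⟨ cong (y A (suc k) xor_) (C-diag k) ⟩
    y A (suc k) xor true             ≡⟨ 𝔹.xor-comm _ true ⟩
    true xor y A (suc k)             ≡⟨ 𝔹.true-xor _ ⟩
    not (y A (suc k))                ∎
    where open ≡-Reasoning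

  bitℚ-+2^-diag : ∀ {A k} → k < B → digit A k ≡ false → bitℚ (y (A + 2 ^ k) (suc k)) ≡ 1ℚ ℚ.- bitℚ (y A (suc k))
  bitℚ-+2^-diag {A} {k} k<B dₖ≡false = trans (cong bitℚ (y-+2^-diag k<B dₖ≡false)) (bitℚ-not (y A (suc k)))

  tail-suc : ∀ A {k} → k < B → tail A k ≡ bitℚ (y A (suc k)) ℚ.* halfPow (suc k) ℚ.+ tail A (suc k)
  tail-suc A k<B = cong (binFrac (y A) _) (ℕP.+-∸-assoc 1 k<B)

  tail-+2^ : ∀ {A k} → k < B → digit A k ≡ false →
    tail (A + 2 ^ k) k ≡ (1ℚ ℚ.- bitℚ (y A (suc k))) ℚ.* halfPow (suc k) ℚ.+ tail A (suc k)
  tail-+2^ {A} {k} k<B dₖ≡false = begin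
    tail (A + 2 ^ k) k
      ≡⟨ tail-suc (A + 2 ^ k) k<B ⟩
    bitℚ (y (A + 2 ^ k) (suc k)) ℚ.* halfPow (suc k) ℚ.+ tail (A + 2 ^ k) (suc k)
      ≡⟨ cong₂ (λ β t → β ℚ.* halfPow (suc k) ℚ.+ t) (bitℚ-+2^-diag k<B dₖ≡false) (tail-local (suc k) above) ⟩
    (1ℚ ℚ.- bitℚ (y A (suc k))) ℚ.* halfPow (suc k) ℚ.+ tail A (suc k) ∎
    where
    open ≡-Reasoning
    above : ∀ j → suc k ≤ j → digit (A + 2 ^ k) j ≡ digit A j
    above j k<j = trans (digit-+2^ k A dₖ≡false j)
      (trans (cong (digit A j xor_) (≢⇒≡ᵇ-false (λ j≡k → ℕP.<-irrefl (sym j≡k) k<j))) (𝔹.xor-identityʳ _))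

  tail-+2^-pair : ∀ {A k} → k < B → digit A k ≡ false →
    tail A k ℚ.+ tail (A + 2 ^ k) k ≡ halfPow (suc k) ℚ.+ (tail A (suc k) ℚ.+ tail A (suc k))
  tail-+2^-pair {A} {k} k<B dₖ≡false = begin
    tail A k ℚ.+ tail (A + 2 ^ k) k
      ≡⟨ cong₂ ℚ._+_ (tail-suc A k<B) (tail-+2^ k<B dₖ≡false) ⟩
    (b ℚ.* h ℚ.+ t) ℚ.+ ((1ℚ ℚ.- b) ℚ.* h ℚ.+ t) ≡⟨ algebra b h t ⟩
    h ℚ.+ (t ℚ.+ t) ∎
    where
    open ≡-Reasoning
    b h t : ℚ
    b = bitℚ (y A (suc k))
    h = halfPow (suc k)
    t = tail A (suc k)
    algebra : ∀ b h t → (b ℚ.* h ℚ.+ t) ℚ.+ ((1ℚ ℚ.- b) ℚ.* h ℚ.+ t) ≡ h ℚ.+ (t ℚ.+ t)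
    algebra = solve-∀ ℚ-ring

  block-sum : ∀ k A → k ≤ B → (∀ j → j < k → digit A j ≡ false) →
    Σ< (2 ^ k) (λ m → tail (A + m) 0) ≡ (pow2 k ℚ.- 1ℚ) ℚ.* ½ ℚ.+ pow2 k ℚ.* tail A k
  block-sum zero A _ _ = begin
    tail (A + 0) 0 ℚ.+ 0ℚ                      ≡⟨ cong (λ n → tail n 0 ℚ.+ 0ℚ) (ℕP.+-identityʳ A) ⟩
    tail A 0 ℚ.+ 0ℚ                            ≡⟨ algebra (tail A 0) ⟩
    (1ℚ ℚ.- 1ℚ) ℚ.* ½ ℚ.+ 1ℚ ℚ.* tail A 0      ∎
    where
    open ≡-Reasoning
    algebra : ∀ t → t ℚ.+ 0ℚ ≡ (1ℚ ℚ.- 1ℚ) ℚ.* ½ ℚ.+ 1ℚ ℚ.* t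
    algebra = solve-∀ ℚ-ring
  block-sum (suc k) A k<B low = begin
    Σ< (2 ^ suc k) x
      ≡⟨ cong (λ n → Σ< (2 ^ k + n) x) (ℕP.+-identityʳ (2 ^ k)) ⟩
    Σ< (2 ^ k + 2 ^ k) x
      ≡⟨ Σ<-+ (2 ^ k) (2 ^ k) x ⟩
    Σ< (2 ^ k) x ℚ.+ Σ< (2 ^ k) (λ m → x (2 ^ k + m))
      ≡⟨ cong (Σ< (2 ^ k) x ℚ.+_) (Σ<-cong (2 ^ k) (λ m _ → cong (λ n → tail n 0) (sym (ℕP.+-assoc A (2 ^ k) m)))) ⟩
    Σ< (2 ^ k) x ℚ.+ Σ< (2 ^ k) (λ m → tail (A + 2 ^ k + m) 0)
      ≡⟨ cong₂ ℚ._+_ (block-sum k A k≤B low′) (block-sum k (A + 2 ^ k) k≤B low″) ⟩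
    ((P ℚ.- 1ℚ) ℚ.* ½ ℚ.+ P ℚ.* tail A k) ℚ.+ ((P ℚ.- 1ℚ) ℚ.* ½ ℚ.+ P ℚ.* tail (A + 2 ^ k) k)
      ≡⟨ algebra₁ P (tail A k) (tail (A + 2 ^ k) k) ⟩
    (P ℚ.- 1ℚ) ℚ.+ P ℚ.* (tail A k ℚ.+ tail (A + 2 ^ k) k)
      ≡⟨ cong (λ s → (P ℚ.- 1ℚ) ℚ.+ P ℚ.* s) (tail-+2^-pair k<B (low k ℕP.≤-refl)) ⟩
    (P ℚ.- 1ℚ) ℚ.+ P ℚ.* (h ℚ.+ (t ℚ.+ t))
      ≡⟨ algebra₂ P h t ⟩
    (P ℚ.- 1ℚ) ℚ.+ P ℚ.* h ℚ.+ (P ℚ.+ P) ℚ.* t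
      ≡⟨ cong (λ c → (P ℚ.- 1ℚ) ℚ.+ c ℚ.+ (P ℚ.+ P) ℚ.* t) (pow2*halfPow-suc k) ⟩
    (P ℚ.- 1ℚ) ℚ.+ ½ ℚ.+ (P ℚ.+ P) ℚ.* t
      ≡⟨ algebra₃ P t ⟩
    ((P ℚ.+ P) ℚ.- 1ℚ) ℚ.* ½ ℚ.+ (P ℚ.+ P) ℚ.* t
      ≡⟨ cong (λ Q → (Q ℚ.- 1ℚ) ℚ.* ½ ℚ.+ Q ℚ.* t) (pow2-suc k) ⟨
    (pow2 (suc k) ℚ.- 1ℚ) ℚ.* ½ ℚ.+ pow2 (suc k) ℚ.* t ∎
    where
    open ≡-Reasoning
    x : ℕ → ℚ
    x m = tail (A + m) 0
    P h t : ℚ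
    P = pow2 k
    h = halfPow (suc k)
    t = tail A (suc k)
    k≤B : k ≤ B
    k≤B = ℕP.<⇒≤ k<B
    low′ : ∀ j → j < k → digit A j ≡ false
    low′ j j<k = low j (ℕP.m<n⇒m<1+n j<k)
    low″ : ∀ j → j < k → digit (A + 2 ^ k) j ≡ false
    low″ j j<k = trans (digit-+2^ k A (low k ℕP.≤-refl) j)
      (cong₂ _xor_ (low′ j j<k) (≢⇒≡ᵇ-false (ℕP.<⇒≢ j<k)))
    algebra₁ : ∀ P a b → ((P ℚ.- 1ℚ) ℚ.* ½ ℚ.+ P ℚ.* a) ℚ.+ ((P ℚ.- 1ℚ) ℚ.* ½ ℚ.+ P ℚ.* b) ≡ (P ℚ.- 1ℚ) ℚ.+ P ℚ.* (a ℚ.+ b)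
    algebra₁ = solve-∀ ℚ-ring
    algebra₂ : ∀ P h t → (P ℚ.- 1ℚ) ℚ.+ P ℚ.* (h ℚ.+ (t ℚ.+ t)) ≡ (P ℚ.- 1ℚ) ℚ.+ P ℚ.* h ℚ.+ (P ℚ.+ P) ℚ.* t
    algebra₂ = solve-∀ ℚ-ring
    algebra₃ : ∀ P t → (P ℚ.- 1ℚ) ℚ.+ ½ ℚ.+ (P ℚ.+ P) ℚ.* t ≡ ((P ℚ.+ P) ℚ.- 1ℚ) ℚ.* ½ ℚ.+ (P ℚ.+ P) ℚ.* t
    algebra₃ = solve-∀ ℚ-ring

  pow2*tail-+2^ : ∀ {A k} → k < B → digit A k ≡ false →
    pow2 k ℚ.* tail A k ≡ ½ ℚ.- bitℚ (y (A + 2 ^ k) (suc k)) ℚ.+ pow2 k ℚ.* tail (A + 2 ^ k) k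
  pow2*tail-+2^ {A} {k} k<B dₖ≡false = begin
    P ℚ.* tail A k
      ≡⟨ cong (P ℚ.*_) (tail-suc A k<B) ⟩
    P ℚ.* (β ℚ.* h ℚ.+ t)
      ≡⟨ algebra₁ P h β t ⟩
    β ℚ.* (P ℚ.* h) ℚ.+ P ℚ.* t
      ≡⟨ cong (λ c → β ℚ.* c ℚ.+ P ℚ.* t) Ph≡½ ⟩
    β ℚ.* ½ ℚ.+ P ℚ.* t
      ≡⟨ algebra₂ β (P ℚ.* t) ⟩
    ½ ℚ.- (1ℚ ℚ.- β) ℚ.+ ((1ℚ ℚ.- β) ℚ.* ½ ℚ.+ P ℚ.* t)
      ≡⟨ cong (λ c → ½ ℚ.- (1ℚ ℚ.- β) ℚ.+ ((1ℚ ℚ.- β) ℚ.* c ℚ.+ P ℚ.* t)) Ph≡½ ⟨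
    ½ ℚ.- (1ℚ ℚ.- β) ℚ.+ ((1ℚ ℚ.- β) ℚ.* (P ℚ.* h) ℚ.+ P ℚ.* t)
      ≡⟨ cong (½ ℚ.- (1ℚ ℚ.- β) ℚ.+_) (algebra₁ P h (1ℚ ℚ.- β) t) ⟨
    ½ ℚ.- (1ℚ ℚ.- β) ℚ.+ P ℚ.* ((1ℚ ℚ.- β) ℚ.* h ℚ.+ t)
      ≡⟨ cong₂ (λ c u → ½ ℚ.- c ℚ.+ P ℚ.* u) (bitℚ-+2^-diag k<B dₖ≡false) (tail-+2^ k<B dₖ≡false) ⟨
    ½ ℚ.- bitℚ (y (A + 2 ^ k) (suc k)) ℚ.+ P ℚ.* tail (A + 2 ^ k) k ∎
    where
    open ≡-Reasoning
    P h t β : ℚ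
    P = pow2 k
    h = halfPow (suc k)
    t = tail A (suc k)
    β = bitℚ (y A (suc k))
    Ph≡½ : P ℚ.* h ≡ ½
    Ph≡½ = pow2*halfPow-suc k
    algebra₁ : ∀ P h β t → P ℚ.* (β ℚ.* h ℚ.+ t) ≡ β ℚ.* (P ℚ.* h) ℚ.+ P ℚ.* t
    algebra₁ = solve-∀ ℚ-ring
    algebra₂ : ∀ β u → β ℚ.* ½ ℚ.+ u ≡ ½ ℚ.- (1ℚ ℚ.- β) ℚ.+ ((1ℚ ℚ.- β) ℚ.* ½ ℚ.+ u)
    algebra₂ = solve-∀ ℚ-ring

module Integral (C : Matrix) (nut : NUT C) (r′ : ℕ) (e : ℕ → ℕ) (e-dec : StrictlyDecreasing (suc r′) e) where
  open Exponents r′ e e-dec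

  N : ℕ
  N = binN (suc r′) e

  B : ℕ
  B = N + suc (E 0)

  open DigitalSequence C nut B

  A : ℕ
  A = prefix r′

  -- P l = 2^{n_{l+1}}, s l = σ_{r,n_{l+1}+1} (see sigma≡y), τ l = tail of x_A beyond digit n_{l+1}.
  P s τ : ℕ → ℚ
  P l = pow2 (E l)
  s l = bitℚ (y A (suc (E l)))
  τ l = tail A (E l)

  s-bounds : ∀ l → 0ℚ ℚ.≤ s l × s l ℚ.≤ 1ℚ
  s-bounds l = bitℚ-bounds (y A (suc (E l)))

  N≤B : N ≤ B
  N≤B = ℕP.m≤m+n N (suc (E 0))

  E0<B : E 0 < B
  E0<B = ℕP.m≤n+m (suc (E 0)) N

  E<B : ∀ {l} → l ≤ r′ → E l < B
  E<B l≤r′ = ℕP.≤-<-trans (E-≤ z≤n l≤r′) E0<B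

  sigma≡y : ∀ i → i ≤ E 0 → sigma C (suc r′) e (suc i) ≡ y A (suc i)
  sigma≡y i i≤E0 = begin
    sigma C (suc r′) e (suc i)
      ≡⟨ Xor.foldr-range≡Σ< (suc i) (suc (E 0)) _ ⟩
    Xor.Σ< (suc (E 0) ∸ i) (λ m → c (i + m) ∧ v (i + m))
      ≡⟨ Xor.Σ<-window i (suc (E 0) ∸ i) B _ i+[E0+1∸i]≤B below above ⟨
    Xor.Σ< B (λ j → c j ∧ v j)
      ≡⟨ Xor.Σ<-cong B (λ j _ → cong (c j ∧_) (vVec≡digit-prefix j)) ⟩
    y A (suc i) ∎
    where
    open ≡-Reasoning
    c : ℕ → Bool
    c j = C (suc i) (suc j)
    v : ℕ → Bool
    v j = vVec (suc r′) e (suc j)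
    i+[E0+1∸i]≤B : i + (suc (E 0) ∸ i) ≤ B
    i+[E0+1∸i]≤B = subst (_≤ B) (sym (ℕP.m+[n∸m]≡n (ℕP.m≤n⇒m≤1+n i≤E0))) E0<B
    below : ∀ j → j < i → c j ∧ v j ≡ false
    below j j<i = cong (_∧ v j) (C-lower i j j<i)
    above : ∀ j → i + (suc (E 0) ∸ i) ≤ j → j < B → c j ∧ v j ≡ false
    above j i+≤j _ = trans (cong (c j ∧_) (trans (vVec≡digit-prefix j) (digit-prefix-high E0<j))) (𝔹.∧-zeroʳ _)
      where
      E0<j : E 0 < j
      E0<j = subst (_≤ j) (ℕP.m+[n∸m]≡n (ℕP.m≤n⇒m≤1+n i≤E0)) i+≤j

  x : ℕ → ℚ
  x m = tail m 0

  Pτ : ℕ → ℚ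
  Pτ l = P l ℚ.* τ l

  block : ∀ {l} → l ≤ r′ →
    Σ< (2 ^ E l) (λ m → x (prefix l + m)) ≡ (P l ℚ.- 1ℚ) ℚ.* ½ ℚ.+ P l ℚ.* tail (prefix l) (E l)
  block l≤r′ = block-sum _ _ (ℕP.<⇒≤ (E<B l≤r′)) (λ j j<E → digit-prefix-low l≤r′ (ℕP.<⇒≤ j<E))

  block-tail : ∀ {l} → l < r′ → P l ℚ.* tail (prefix l) (E l) ≡ ½ ℚ.- s l ℚ.+ P l ℚ.* τ l
  block-tail {l} l<r′ = begin
    P l ℚ.* tail (prefix l) (E l)
      ≡⟨ pow2*tail-+2^ (E<B l≤r′) (digit-prefix-low l≤r′ ℕP.≤-refl) ⟩
    ½ ℚ.- bitℚ (y (prefix (suc l)) (suc (E l))) ℚ.+ P l ℚ.* tail (prefix (suc l)) (E l)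
      ≡⟨ cong₂ (λ b t → ½ ℚ.- bitℚ b ℚ.+ P l ℚ.* t) (y-local (E l) agree) (tail-local (E l) agree) ⟩
    ½ ℚ.- s l ℚ.+ P l ℚ.* τ l ∎
    where
    open ≡-Reasoning
    l≤r′ : l ≤ r′
    l≤r′ = ℕP.<⇒≤ l<r′
    agree : ∀ j → E l ≤ j → digit (prefix (suc l)) j ≡ digit A j
    agree j El≤j = sym (digit-prefix-stable l<r′ El≤j)

  Σx-prefix : ∀ L → L ≤ r′ → Σ< (prefix L) x ≡ Σ< L P ℚ.* ½ ℚ.- Σ< L s ℚ.+ Σ< L Pτ
  Σx-prefix zero    _      = refl
  Σx-prefix (suc L) sL≤r′ = begin
    Σ< (prefix L + 2 ^ E L) x
      ≡⟨ Σ<-+ (prefix L) (2 ^ E L) x ⟩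
    Σ< (prefix L) x ℚ.+ Σ< (2 ^ E L) (λ m → x (prefix L + m))
      ≡⟨ cong₂ ℚ._+_ (Σx-prefix L L≤r′) (block L≤r′) ⟩
    Σ< L P ℚ.* ½ ℚ.- Σ< L s ℚ.+ Σ< L Pτ ℚ.+ ((P L ℚ.- 1ℚ) ℚ.* ½ ℚ.+ P L ℚ.* tail (prefix L) (E L))
      ≡⟨ cong (λ z → Σ< L P ℚ.* ½ ℚ.- Σ< L s ℚ.+ Σ< L Pτ ℚ.+ ((P L ℚ.- 1ℚ) ℚ.* ½ ℚ.+ z)) (block-tail sL≤r′) ⟩
    Σ< L P ℚ.* ½ ℚ.- Σ< L s ℚ.+ Σ< L Pτ ℚ.+ ((P L ℚ.- 1ℚ) ℚ.* ½ ℚ.+ (½ ℚ.- s L ℚ.+ Pτ L))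
      ≡⟨ algebra (Σ< L P) (Σ< L s) (Σ< L Pτ) (P L) (s L) (Pτ L) ⟩
    (Σ< L P ℚ.+ P L) ℚ.* ½ ℚ.- (Σ< L s ℚ.+ s L) ℚ.+ (Σ< L Pτ ℚ.+ Pτ L)
      ≡⟨ cong₂ (λ a b → a ℚ.* ½ ℚ.- b ℚ.+ (Σ< L Pτ ℚ.+ Pτ L)) (Σ<-suc L P) (Σ<-suc L s) ⟨
    Σ< (suc L) P ℚ.* ½ ℚ.- Σ< (suc L) s ℚ.+ (Σ< L Pτ ℚ.+ Pτ L)
      ≡⟨ cong (Σ< (suc L) P ℚ.* ½ ℚ.- Σ< (suc L) s ℚ.+_) (Σ<-suc L Pτ) ⟨
    Σ< (suc L) P ℚ.* ½ ℚ.- Σ< (suc L) s ℚ.+ Σ< (suc L) Pτ ∎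
    where
    open ≡-Reasoning
    L≤r′ : L ≤ r′
    L≤r′ = ℕP.<⇒≤ sL≤r′
    algebra : ∀ F S T p σ q →
      F ℚ.* ½ ℚ.- S ℚ.+ T ℚ.+ ((p ℚ.- 1ℚ) ℚ.* ½ ℚ.+ (½ ℚ.- σ ℚ.+ q)) ≡ (F ℚ.+ p) ℚ.* ½ ℚ.- (S ℚ.+ σ) ℚ.+ (T ℚ.+ q)
    algebra = solve-∀ ℚ-ring

  toℚ-N : toℚ N ≡ Σ< r′ P ℚ.+ P r′
  toℚ-N = begin
    toℚ N                                  ≡⟨ cong toℚ (Nat.foldr-range≡Σ< 1 (suc r′) (λ l → 2 ^ e l)) ⟩
    toℚ (Nat.Σ< (suc r′) (λ l → 2 ^ E l))  ≡⟨ toℚ-Σ< (suc r′) (λ l → 2 ^ E l) ⟩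
    Σ< (suc r′) P                          ≡⟨ Σ<-suc r′ P ⟩
    Σ< r′ P ℚ.+ P r′                       ∎
    where open ≡-Reasoning

  Σx-N : Σ< N x ≡ Σ< r′ P ℚ.* ½ ℚ.- Σ< r′ s ℚ.+ Σ< r′ Pτ ℚ.+ ((P r′ ℚ.- 1ℚ) ℚ.* ½ ℚ.+ Pτ r′)
  Σx-N = begin
    Σ< N x                                            ≡⟨ cong (λ n → Σ< n x) binN≡prefix ⟩
    Σ< (A + 2 ^ E r′) x                               ≡⟨ Σ<-+ A (2 ^ E r′) x ⟩
    Σ< A x ℚ.+ Σ< (2 ^ E r′) (λ m → x (A + m))       ≡⟨ cong₂ ℚ._+_ (Σx-prefix r′ ℕP.≤-refl) (block ℕP.≤-refl) ⟩
    Σ< r′ P ℚ.* ½ ℚ.- Σ< r′ s ℚ.+ Σ< r′ Pτ ℚ.+ ((P r′ ℚ.- 1ℚ) ℚ.* ½ ℚ.+ Pτ r′) ∎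
    where open ≡-Reasoning

  intDiscrepancy≡Σx : intDiscrepancy C N ≡ toℚ N ℚ.- Σ< N x ℚ.- toℚ N ℚ.* ½
  intDiscrepancy≡Σx = begin
    intDiscrepancy C N
      ≡⟨ cong (ℚ._- toℚ N ℚ.* ½) (foldr-range≡Σ< 0 (N ∸ 1) (λ m → 1ℚ ℚ.- xSeq C m)) ⟩
    Σ< (suc (N ∸ 1)) (λ m → 1ℚ ℚ.- xSeq C m) ℚ.- toℚ N ℚ.* ½
      ≡⟨ cong (λ n → Σ< n (λ m → 1ℚ ℚ.- xSeq C m) ℚ.- toℚ N ℚ.* ½) (ℕP.m+[n∸m]≡n 1≤N) ⟩
    Σ< N (λ m → 1ℚ ℚ.- xSeq C m) ℚ.- toℚ N ℚ.* ½
      ≡⟨ cong (ℚ._- toℚ N ℚ.* ½) (Σ<-cong N (λ m m<N → cong (λ z → 1ℚ ℚ.- z) (xSeq≡tail (m≤B m<N)))) ⟩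
    Σ< N (λ m → 1ℚ ℚ.- x m) ℚ.- toℚ N ℚ.* ½
      ≡⟨ cong (ℚ._- toℚ N ℚ.* ½) (Σ<-1- N x) ⟩
    toℚ N ℚ.- Σ< N x ℚ.- toℚ N ℚ.* ½ ∎
    where
    open ≡-Reasoning
    1≤N : 1 ≤ N
    1≤N = subst (1 ≤_) (sym binN≡prefix) (ℕP.≤-trans (ℕP.m^n>0 2 (E r′)) (ℕP.m≤n+m _ A))
    m≤B : ∀ {m} → m < N → m ≤ B
    m≤B m<N = ℕP.<⇒≤ (ℕP.<-≤-trans m<N N≤B)

  intDiscrepancy≡ : intDiscrepancy C N ≡ ½ ℚ.+ Σ< r′ s ℚ.- Σ< (suc r′) Pτ
  intDiscrepancy≡ = begin
    intDiscrepancy C N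
      ≡⟨ intDiscrepancy≡Σx ⟩
    toℚ N ℚ.- Σ< N x ℚ.- toℚ N ℚ.* ½
      ≡⟨ cong₂ (λ n σ → n ℚ.- σ ℚ.- n ℚ.* ½) toℚ-N Σx-N ⟩
    (F ℚ.+ P r′) ℚ.- (F ℚ.* ½ ℚ.- S ℚ.+ ΣPτ ℚ.+ ((P r′ ℚ.- 1ℚ) ℚ.* ½ ℚ.+ Pτ r′)) ℚ.- (F ℚ.+ P r′) ℚ.* ½
      ≡⟨ algebra F S ΣPτ (P r′) (Pτ r′) ⟩
    ½ ℚ.+ S ℚ.- (ΣPτ ℚ.+ Pτ r′)
      ≡⟨ cong (λ z → ½ ℚ.+ S ℚ.- z) (Σ<-suc r′ Pτ) ⟨
    ½ ℚ.+ S ℚ.- Σ< (suc r′) Pτ ∎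
    where
    open ≡-Reasoning
    F S ΣPτ : ℚ
    F = Σ< r′ P
    S = Σ< r′ s
    ΣPτ = Σ< r′ Pτ
    algebra : ∀ F S R p q →
      (F ℚ.+ p) ℚ.- (F ℚ.* ½ ℚ.- S ℚ.+ R ℚ.+ ((p ℚ.- 1ℚ) ℚ.* ½ ℚ.+ q)) ℚ.- (F ℚ.+ p) ℚ.* ½ ≡ ½ ℚ.+ S ℚ.- (R ℚ.+ q)
    algebra = solve-∀ ℚ-ring

  Q : ℕ → ℚ
  Q k = toℚ (Nat.Σ< (suc r′ ∸ k) (λ t → 2 ^ E (k + t)))

  Q-step : ∀ {k} → k ≤ r′ → Q k ≡ P k ℚ.+ Q (suc k)
  Q-step {k} k≤r′ = begin
    Q k
      ≡⟨ cong (λ n → toℚ (Nat.Σ< n (λ t → 2 ^ E (k + t)))) (ℕP.+-∸-assoc 1 k≤r′) ⟩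
    toℚ (2 ^ E (k + 0) + Nat.Σ< (r′ ∸ k) (λ t → 2 ^ E (k + suc t)))
      ≡⟨ toℚ-+ (2 ^ E (k + 0)) _ ⟩
    pow2 (E (k + 0)) ℚ.+ toℚ (Nat.Σ< (r′ ∸ k) (λ t → 2 ^ E (k + suc t)))
      ≡⟨ cong₂ (λ i σ → pow2 (E i) ℚ.+ toℚ σ) (ℕP.+-identityʳ k) (Nat.Σ<-cong (r′ ∸ k) (λ t _ → cong (λ i → 2 ^ E i) (ℕP.+-suc k t))) ⟩
    P k ℚ.+ Q (suc k) ∎
    where open ≡-Reasoning

  Q-last : Q r′ ≡ P r′
  Q-last = begin
    Q r′                    ≡⟨ Q-step ℕP.≤-refl ⟩
    P r′ ℚ.+ Q (suc r′)     ≡⟨ cong (λ n → P r′ ℚ.+ toℚ (Nat.Σ< n (λ t → 2 ^ E (suc r′ + t)))) (ℕP.n∸n≡0 r′) ⟩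
    P r′ ℚ.+ 0ℚ             ≡⟨ ℚP.+-identityʳ (P r′) ⟩
    P r′                    ∎
    where open ≡-Reasoning

  Q-first : Q 0 ≡ toℚ N
  Q-first = cong toℚ (sym (Nat.foldr-range≡Σ< 1 (suc r′) (λ l → 2 ^ e l)))

  segment≡Δτ : ∀ {m} → m < r′ → binFrac (y A) (E (suc m)) (E m ∸ E (suc m)) ≡ τ (suc m) ℚ.- τ m
  segment≡Δτ {m} m<r′ = begin
    w                       ≡⟨ algebra w (τ m) ⟩
    w ℚ.+ τ m ℚ.- τ m       ≡⟨ cong (ℚ._- τ m) (binFrac-split (y A) E₊≤E E≤B) ⟨
    τ (suc m) ℚ.- τ m       ∎
    where
    open ≡-Reasoning
    w : ℚ
    w = binFrac (y A) (E (suc m)) (E m ∸ E (suc m))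
    E₊≤E : E (suc m) ≤ E m
    E₊≤E = ℕP.<⇒≤ (E-suc< m<r′)
    E≤B : E m ≤ B
    E≤B = ℕP.<⇒≤ (E<B (ℕP.<⇒≤ m<r′))
    algebra : ∀ a b → a ≡ a ℚ.+ b ℚ.- b
    algebra = solve-∀ ℚ-ring

  weighted : ℕ → ℚ
  weighted k = ΣQ (suc (e k)) (e (k ∸ 1)) (λ j →
    (bitℚ (sigma C (suc r′) e j) ℚ.* halfPow j) ℚ.* toℚ (ΣN k (suc r′) (λ i → 2 ^ e i)))

  weighted≡ : ∀ {m} → m < r′ → weighted (2 + m) ≡ Q (suc m) ℚ.* (τ (suc m) ℚ.- τ m)
  weighted≡ {m} m<r′ = begin
    weighted (2 + m)
      ≡⟨ foldr-range≡Σ< (suc (E (suc m))) (E m) _ ⟩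
    Σ< (E m ∸ E (suc m)) (λ t → σ-term (suc (E (suc m) + t)) ℚ.* Q′)
      ≡⟨ Σ<-*ʳ (E m ∸ E (suc m)) _ Q′ ⟩
    Σ< (E m ∸ E (suc m)) (λ t → σ-term (suc (E (suc m) + t))) ℚ.* Q′
      ≡⟨ cong (ℚ._* Q′) (Σ<≡binFrac (sigma C (suc r′) e) (E (suc m)) (E m ∸ E (suc m))) ⟩
    binFrac (sigma C (suc r′) e) (E (suc m)) (E m ∸ E (suc m)) ℚ.* Q′
      ≡⟨ cong (ℚ._* Q′) (binFrac-cong (E (suc m)) (E m ∸ E (suc m)) σ≡y) ⟩
    binFrac (y A) (E (suc m)) (E m ∸ E (suc m)) ℚ.* Q′
      ≡⟨ cong₂ ℚ._*_ (segment≡Δτ m<r′) Q′≡Q ⟩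
    (τ (suc m) ℚ.- τ m) ℚ.* Q (suc m)
      ≡⟨ ℚP.*-comm _ (Q (suc m)) ⟩
    Q (suc m) ℚ.* (τ (suc m) ℚ.- τ m) ∎
    where
    open ≡-Reasoning
    Q′ : ℚ
    Q′ = toℚ (ΣN (2 + m) (suc r′) (λ i → 2 ^ e i))
    Q′≡Q : Q′ ≡ Q (suc m)
    Q′≡Q = cong toℚ (Nat.foldr-range≡Σ< (2 + m) (suc r′) (λ i → 2 ^ e i))
    σ-term : ℕ → ℚ
    σ-term j = bitℚ (sigma C (suc r′) e j) ℚ.* halfPow j
    σ≡y : ∀ i → E (suc m) < i → i ≤ E (suc m) + (E m ∸ E (suc m)) → sigma C (suc r′) e i ≡ y A i
    σ≡y (suc i) _ i<… = sigma≡y i (ℕP.<⇒≤ (ℕP.<-≤-trans i<E (E-≤ z≤n (ℕP.<⇒≤ m<r′))))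
      where
      i<E : i < E m
      i<E = subst (suc i ≤_) (ℕP.m+[n∸m]≡n (ℕP.<⇒≤ (E-suc< m<r′))) i<…

  Σweighted≡ : ΣQ 2 (suc r′) weighted ≡ Σ< (suc r′) Pτ ℚ.- toℚ N ℚ.* τ 0
  Σweighted≡ = begin
    ΣQ 2 (suc r′) weighted
      ≡⟨ foldr-range≡Σ< 2 (suc r′) weighted ⟩
    Σ< r′ (λ m → weighted (2 + m))
      ≡⟨ Σ<-cong r′ (λ m m<r′ → weighted≡ m<r′) ⟩
    Σ< r′ (λ k → Q (suc k) ℚ.* (τ (suc k) ℚ.- τ k))
      ≡⟨ Σ<-by-parts r′ Q τ ⟩
    Q r′ ℚ.* τ r′ ℚ.- Q 0 ℚ.* τ 0 ℚ.+ Σ< r′ (λ k → (Q k ℚ.- Q (suc k)) ℚ.* τ k)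
      ≡⟨ cong₂ (λ a b → a ℚ.* τ r′ ℚ.- b ℚ.* τ 0 ℚ.+ Σ< r′ (λ k → (Q k ℚ.- Q (suc k)) ℚ.* τ k)) Q-last Q-first ⟩
    Pτ r′ ℚ.- toℚ N ℚ.* τ 0 ℚ.+ Σ< r′ (λ k → (Q k ℚ.- Q (suc k)) ℚ.* τ k)
      ≡⟨ cong (Pτ r′ ℚ.- toℚ N ℚ.* τ 0 ℚ.+_) (Σ<-cong r′ (λ k k<r′ → cong (ℚ._* τ k) (ΔQ (ℕP.<⇒≤ k<r′)))) ⟩
    Pτ r′ ℚ.- toℚ N ℚ.* τ 0 ℚ.+ Σ< r′ Pτ
      ≡⟨ algebra (Pτ r′) (toℚ N ℚ.* τ 0) (Σ< r′ Pτ) ⟩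
    Σ< r′ Pτ ℚ.+ Pτ r′ ℚ.- toℚ N ℚ.* τ 0
      ≡⟨ cong (ℚ._- toℚ N ℚ.* τ 0) (Σ<-suc r′ Pτ) ⟨
    Σ< (suc r′) Pτ ℚ.- toℚ N ℚ.* τ 0 ∎
    where
    open ≡-Reasoning
    ΔQ : ∀ {k} → k ≤ r′ → Q k ℚ.- Q (suc k) ≡ P k
    ΔQ {k} k≤r′ = trans (cong (ℚ._- Q (suc k)) (Q-step k≤r′)) (algebra′ (P k) (Q (suc k)))
      where
      algebra′ : ∀ a b → a ℚ.+ b ℚ.- b ≡ a
      algebra′ = solve-∀ ℚ-ring
    algebra : ∀ a b c → a ℚ.- b ℚ.+ c ≡ c ℚ.+ a ℚ.- b
    algebra = solve-∀ ℚ-ring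

  mainTerm≡ : mainTerm C (suc r′) e ≡ Σ< r′ (λ l → s (suc l)) ℚ.- (Σ< (suc r′) Pτ ℚ.- toℚ N ℚ.* τ 0)
  mainTerm≡ = cong₂ ℚ._-_ Σσ≡ Σweighted≡
    where
    Σσ≡ : ΣQ 2 (suc r′) (λ i → bitℚ (sigma C (suc r′) e (suc (e i)))) ≡ Σ< r′ (λ l → s (suc l))
    Σσ≡ = trans (foldr-range≡Σ< 2 (suc r′) _)
      (Σ<-cong r′ (λ l l<r′ → cong bitℚ (sigma≡y (E (suc l)) (E-≤ z≤n l<r′))))

  difference≡ : intDiscrepancy C N ℚ.- mainTerm C (suc r′) e ≡ ½ ℚ.+ s 0 ℚ.- s r′ ℚ.- toℚ N ℚ.* τ 0
  difference≡ = begin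
    intDiscrepancy C N ℚ.- mainTerm C (suc r′) e
      ≡⟨ cong₂ ℚ._-_ intDiscrepancy≡ mainTerm≡ ⟩
    ½ ℚ.+ S ℚ.- ΣPτ ℚ.- (U ℚ.- (ΣPτ ℚ.- X))
      ≡⟨ algebra₁ S ΣPτ U X (s 0) (s r′) ⟩
    ½ ℚ.+ (S ℚ.+ s r′) ℚ.- (s 0 ℚ.+ U) ℚ.+ s 0 ℚ.- s r′ ℚ.- X
      ≡⟨ cong (λ z → ½ ℚ.+ z ℚ.- (s 0 ℚ.+ U) ℚ.+ s 0 ℚ.- s r′ ℚ.- X) (Σ<-suc r′ s) ⟨
    ½ ℚ.+ Σ< (suc r′) s ℚ.- Σ< (suc r′) s ℚ.+ s 0 ℚ.- s r′ ℚ.- X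
      ≡⟨ algebra₂ (Σ< (suc r′) s) (s 0) (s r′) X ⟩
    ½ ℚ.+ s 0 ℚ.- s r′ ℚ.- X ∎
    where
    open ≡-Reasoning
    S ΣPτ U X : ℚ
    S = Σ< r′ s
    ΣPτ = Σ< (suc r′) Pτ
    U = Σ< r′ (λ l → s (suc l))
    X = toℚ N ℚ.* τ 0
    algebra₁ : ∀ S R U X a b → ½ ℚ.+ S ℚ.- R ℚ.- (U ℚ.- (R ℚ.- X)) ≡ ½ ℚ.+ (S ℚ.+ b) ℚ.- (a ℚ.+ U) ℚ.+ a ℚ.- b ℚ.- X
    algebra₁ = solve-∀ ℚ-ring
    algebra₂ : ∀ σ a b X → ½ ℚ.+ σ ℚ.- σ ℚ.+ a ℚ.- b ℚ.- X ≡ ½ ℚ.+ a ℚ.- b ℚ.- X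
    algebra₂ = solve-∀ ℚ-ring

  Nτ₀-bounds : 0ℚ ℚ.≤ toℚ N ℚ.* τ 0 × toℚ N ℚ.* τ 0 ℚ.≤ 1ℚ ℚ.+ 1ℚ
  Nτ₀-bounds = *-mono-≤-nonNeg ℚP.≤-refl (0≤toℚ N) ℚP.≤-refl 0≤τ₀ , (begin
    toℚ N ℚ.* τ 0                        ≤⟨ *-mono-≤-nonNeg (0≤toℚ N) N≤2^[E0+1] 0≤τ₀ τ₀≤halfPow ⟩
    pow2 (suc (E 0)) ℚ.* halfPow (E 0)   ≡⟨ pow2-suc*halfPow (E 0) ⟩
    1ℚ ℚ.+ 1ℚ                            ∎)
    where
    open ℚP.≤-Reasoning
    0≤τ₀ : 0ℚ ℚ.≤ τ 0
    0≤τ₀ = proj₁ (binFrac-bounds (y A) (E 0) (B ∸ E 0))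
    τ₀≤halfPow : τ 0 ℚ.≤ halfPow (E 0)
    τ₀≤halfPow = proj₂ (binFrac-bounds (y A) (E 0) (B ∸ E 0))
    N≤2^[E0+1] : toℚ N ℚ.≤ pow2 (suc (E 0))
    N≤2^[E0+1] = toℚ-mono-≤ (subst (_≤ 2 ^ suc (E 0)) (sym binN≡prefix) prefix-bound)

lemma1 : (C : Matrix) → NUT C →
    Σ ℚ (λ K → (r : ℕ) → (e : ℕ → ℕ) → 1 ≤ r → StrictlyDecreasing r e →
      ∣ intDiscrepancy C (binN r e) - mainTerm C r e ∣ ≤ℚ K)
lemma1 C nut = K , bounded
  where
  K : ℚ
  K = ½ ℚ.+ 1ℚ ℚ.+ 1ℚ ℚ.+ (1ℚ ℚ.+ 1ℚ)
  bounded : (r : ℕ) → (e : ℕ → ℕ) → 1 ≤ r → StrictlyDecreasing r e →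
    ∣ intDiscrepancy C (binN r e) - mainTerm C r e ∣ ≤ℚ K
  bounded (suc r′) e _ e-dec = begin
    ∣ intDiscrepancy C N - mainTerm C (suc r′) e ∣    ≡⟨ cong ∣_∣ difference≡ ⟩
    ∣ ½ ℚ.+ s 0 ℚ.- s r′ ℚ.- toℚ N ℚ.* τ 0 ∣          ≤⟨ ∣½+a-b-c∣≤ (s-bounds 0) (s-bounds r′) Nτ₀-bounds ⟩
    K                                                 ∎
    where
    open Integral C nut r′ e e-dec
    open ℚP.≤-Reasoning
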